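{- Let $X_A$ and $X_B$ be disjoint finite sets (possibly empty), and let $x$ be an element belonging to neither $X_A$ nor $X_B$. Let $(S_A,R_A)$ be a Catalan pair on $X_A$ and $(S_B,R_B)$ a Catalan pair on $X_B$ (on the empty set the only such pair is $(\emptyset,\emptyset)$). Put $X_C = X_A\cup X_B\cup\{x\}$ and define binary relations on $X_C$ by $$S = S_A\cup S_B\cup\{(a,x): a\in X_A\},$$ $$R = R_A\cup R_B\cup\{(a,b): a\in X_A,\ b\in X_B\}\cup\{(x,b): b\in X_B\}.$$ Then $(S,R)$ is a Catalan pair on $X_C$.
   Context: For a set $X$, let $\mathcal{D}=\{(x,x): x\in X\}$ be the diagonal, and for a binary relation $\theta$ on $X$ let $\overline{\theta}=\theta\cup\theta^{ -1}$. A strict order relation on $X$ is an irreflexive and transitive binary relation. An ordered pair $(S,R)$ of binary relations on a finite set $X$ is a Catalan pair on $X$ if: (i) $S$ and $R$ are strict order relations on $X$; (ii) $\overline{R}\cup\overline{S}=X^2\setminus\mathcal{D}$; (iii) $\overline{R}\cap\overline{S}=\emptyset$; (iv) $S\circ R\subseteq R$, i.e. whenever $xSy$ and $yRz$ then $xRz$. -}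

module Defs where

open import Level using (Level; _⊔_; suc)
open import Data.Product using (_×_; Σ; ∃)
open import Data.Sum using (_⊎_)
open import Data.Empty using (⊥)
open import Data.List using (List)
open import Data.List.Membership.Propositional using (_∈_)
open import Relation.Nullary using (¬_)
open import Relation.Binary.PropositionalEquality using (_≡_)

Subset : ∀ {a} → Set a → Set (suc a)
Subset {a} U = U → Set a

Rel₂ : ∀ {a} → Set a → Set (suc a)
Rel₂ {a} U = U → U → Set a

Finite : ∀ {a} {U : Set a} → Subset U → Set a
Finite {U = U} X = Σ (List U) λ l → ∀ u → X u → u ∈ l

RelOn : ∀ {a} {U : Set a} → Subset U → Rel₂ U → Set a
RelOn X θ = ∀ u v → θ u v → X u × X v

IsStrictOrder : ∀ {a} {U : Set a} → Rel₂ U → Set a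
IsStrictOrder θ = (∀ u → ¬ θ u u) × (∀ u v w → θ u v → θ v w → θ u w)

sym-closure : ∀ {a} {U : Set a} → Rel₂ U → Rel₂ U
sym-closure θ u v = θ u v ⊎ θ v u

record CatalanPair {a} {U : Set a} (X : Subset U) (S R : Rel₂ U) : Set a where
  field
    S-on : RelOn X S
    R-on : RelOn X R
    S-strict : IsStrictOrder S
    R-strict : IsStrictOrder R
    -- (ii) R̄ ∪ S̄ = X² ∖ D  (⊆ direction is given by S-on, R-on, irreflexivity)
    cover : ∀ u v → X u → X v → ¬ u ≡ v → sym-closure R u v ⊎ sym-closure S u v
    disjoint : ∀ u v → sym-closure R u v → sym-closure S u v → ⊥
    compat : ∀ u v w → S u v → R v w → R u w

_∪ₛ_ : ∀ {a} {U : Set a} → Subset U → Subset U → Subset U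
(X ∪ₛ Y) u = X u ⊎ Y u

_∪ᵣ_ : ∀ {a} {U : Set a} → Rel₂ U → Rel₂ U → Rel₂ U
(θ ∪ᵣ φ) u v = θ u v ⊎ φ u v

｛_｝ : ∀ {a} {U : Set a} → U → Subset U
｛ x ｝ u = u ≡ x

_×ᵣ_ : ∀ {a} {U : Set a} → Subset U → Subset U → Rel₂ U
(X ×ᵣ Y) u v = X u × Y v

module Submission where

-- The Catalan pair on X_C is assembled from two general operations.
--
--   * Adding a top element: if (S , R) is a Catalan pair on X and x ∉ X,
--     then (S ∪ X × {x} , R) is a Catalan pair on X ∪ {x}
--     (x lies S-above every element of X and is R-incomparable to all).
--   * Sum: if (S₁ , R₁) and (S₂ , R₂) are Catalan pairs on disjoint sets
--     X and Y, then (S₁ ∪ S₂ , R₁ ∪ R₂ ∪ X × Y) is a Catalan pair on X ∪ Y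
--     (S is the disjoint union, R the ordinal sum of the two orders).
--
-- Applying the sum to (the pair on X_A with x added on top) and (S_B , R_B)
-- yields exactly the relations of the theorem, up to reassociating unions;
-- a transport lemma moves Catalan pairs along such pointwise equivalences.

open import Defs
open import Data.Product using (_×_; _,_; proj₁; proj₂; swap)
open import Data.Sum as Sum using (_⊎_; inj₁; inj₂)
open import Data.Empty using (⊥; ⊥-elim)
open import Relation.Nullary using (¬_)
open import Relation.Binary.PropositionalEquality using (_≡_; refl)

module _ {a} {U : Set a} where

  private variable
    X X′ Y Z : Subset U
    θ φ S S′ R R′ S₁ R₁ S₂ R₂ : Rel₂ U
    u v x : U

  _⊆ₛ_ : Subset U → Subset U → Set a
  X ⊆ₛ Y = ∀ {u} → X u → Y u

  _⇔ₛ_ : Subset U → Subset U → Set a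
  X ⇔ₛ Y = X ⊆ₛ Y × Y ⊆ₛ X

  _⊆ᵣ_ : Rel₂ U → Rel₂ U → Set a
  θ ⊆ᵣ φ = ∀ {u v} → θ u v → φ u v

  _⇔ᵣ_ : Rel₂ U → Rel₂ U → Set a
  θ ⇔ᵣ φ = θ ⊆ᵣ φ × φ ⊆ᵣ θ

  Disjoint : Subset U → Subset U → Set a
  Disjoint X Y = ∀ u → X u → Y u → ⊥

  src : RelOn X θ → θ u v → X u
  src on t = proj₁ (on _ _ t)

  tgt : RelOn X θ → θ u v → X v
  tgt on t = proj₂ (on _ _ t)

  RelOn-weaken : X ⊆ₛ Z → RelOn X θ → RelOn Z θ
  RelOn-weaken X⊆Z on u v t = X⊆Z (src on t) , X⊆Z (tgt on t)

  RelOn-∪ : RelOn Z θ → RelOn Z φ → RelOn Z (θ ∪ᵣ φ)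
  RelOn-∪ onθ onφ u v (inj₁ t) = onθ u v t
  RelOn-∪ onθ onφ u v (inj₂ t) = onφ u v t

  RelOn-× : X ⊆ₛ Z → Y ⊆ₛ Z → RelOn Z (X ×ᵣ Y)
  RelOn-× X⊆Z Y⊆Z u v (p , q) = X⊆Z p , Y⊆Z q

  sym-mono : θ ⊆ᵣ φ →
             ∀ u v → sym-closure θ u v → sym-closure φ u v
  sym-mono θ⊆φ u v = Sum.map θ⊆φ θ⊆φ

  sym-∪ : sym-closure (θ ∪ᵣ φ) u v →
          sym-closure θ u v ⊎ sym-closure φ u v
  sym-∪ (inj₁ (inj₁ t)) = inj₁ (inj₁ t)
  sym-∪ (inj₁ (inj₂ t)) = inj₂ (inj₁ t)
  sym-∪ (inj₂ (inj₁ t)) = inj₁ (inj₂ t)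
  sym-∪ (inj₂ (inj₂ t)) = inj₂ (inj₂ t)

  sym-on : RelOn X θ → sym-closure θ u v → X u × X v
  sym-on on (inj₁ t) = on _ _ t
  sym-on on (inj₂ t) = swap (on _ _ t)

  -- Condition (iii) only needs to be checked for R itself, since both
  -- closures are symmetric.
  apart-from-one-side : (∀ u v → R u v → sym-closure S u v → ⊥) →
                        ∀ u v → sym-closure R u v → sym-closure S u v → ⊥
  apart-from-one-side apart u v (inj₁ r) s = apart u v r s
  apart-from-one-side apart u v (inj₂ r) s = apart v u r (Sum.swap s)

  strict-resp : θ ⇔ᵣ φ → IsStrictOrder θ → IsStrictOrder φ
  strict-resp (θ⊆φ , φ⊆θ) (irr , trans) =
    (λ u t → irr u (φ⊆θ t)) ,
    (λ u v w s t → θ⊆φ (trans u v w (φ⊆θ s) (φ⊆θ t)))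

  strict-disjoint-union : Disjoint X Y → RelOn X θ → RelOn Y φ →
    IsStrictOrder θ → IsStrictOrder φ → IsStrictOrder (θ ∪ᵣ φ)
  strict-disjoint-union {θ = θ} {φ = φ} X∩Y onθ onφ (irrθ , trθ) (irrφ , trφ) =
    irr , trans
    where
    irr : ∀ u → ¬ (θ ∪ᵣ φ) u u
    irr u (inj₁ s) = irrθ u s
    irr u (inj₂ s) = irrφ u s
    trans : ∀ u v w → (θ ∪ᵣ φ) u v → (θ ∪ᵣ φ) v w → (θ ∪ᵣ φ) u w
    trans u v w (inj₁ s) (inj₁ t) = inj₁ (trθ u v w s t)
    trans u v w (inj₁ s) (inj₂ t) = ⊥-elim (X∩Y v (tgt onθ s) (src onφ t))
    trans u v w (inj₂ s) (inj₁ t) = ⊥-elim (X∩Y v (src onθ t) (tgt onφ s))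
    trans u v w (inj₂ s) (inj₂ t) = inj₂ (trφ u v w s t)

  strict-ordinal-sum : Disjoint X Y → RelOn X θ → RelOn Y φ →
    IsStrictOrder θ → IsStrictOrder φ →
    IsStrictOrder ((θ ∪ᵣ φ) ∪ᵣ (X ×ᵣ Y))
  strict-ordinal-sum {X = X} {Y = Y} {θ = θ} {φ = φ} X∩Y onθ onφ sθ sφ =
    irr , trans
    where
    ρ : Rel₂ U
    ρ = (θ ∪ᵣ φ) ∪ᵣ (X ×ᵣ Y)
    union : IsStrictOrder (θ ∪ᵣ φ)
    union = strict-disjoint-union X∩Y onθ onφ sθ sφ
    irr : ∀ u → ¬ ρ u u
    irr u (inj₁ s) = proj₁ union u s
    irr u (inj₂ (p , q)) = X∩Y u p q
    trans : ∀ u v w → ρ u v → ρ v w → ρ u w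
    trans u v w (inj₁ s) (inj₁ t) = inj₁ (proj₂ union u v w s t)
    trans u v w (inj₁ (inj₁ s)) (inj₂ (_ , q)) = inj₂ (src onθ s , q)
    trans u v w (inj₁ (inj₂ s)) (inj₂ (p , _)) = ⊥-elim (X∩Y v p (tgt onφ s))
    trans u v w (inj₂ (p , q)) (inj₁ (inj₁ t)) = ⊥-elim (X∩Y v (src onθ t) q)
    trans u v w (inj₂ (p , _)) (inj₁ (inj₂ t)) = inj₂ (p , tgt onφ t)
    trans u v w (inj₂ (_ , q)) (inj₂ (p , _)) = ⊥-elim (X∩Y v p q)

  strict-top : ¬ X x → RelOn X θ →
    IsStrictOrder θ → IsStrictOrder (θ ∪ᵣ (X ×ᵣ ｛ x ｝))
  strict-top {X = X} {x = x} {θ = θ} x∉X on (irrθ , trθ) = irr , trans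
    where
    ρ : Rel₂ U
    ρ = θ ∪ᵣ (X ×ᵣ ｛ x ｝)
    irr : ∀ u → ¬ ρ u u
    irr u (inj₁ s) = irrθ u s
    irr u (inj₂ (p , refl)) = x∉X p
    trans : ∀ u v w → ρ u v → ρ v w → ρ u w
    trans u v w (inj₁ s) (inj₁ t) = inj₁ (trθ u v w s t)
    trans u v w (inj₁ s) (inj₂ (_ , e)) = inj₂ (src on s , e)
    trans u v w (inj₂ (_ , refl)) (inj₁ t) = ⊥-elim (x∉X (src on t))
    trans u v w (inj₂ (_ , refl)) (inj₂ (p , _)) = ⊥-elim (x∉X p)

  CatalanPair-resp : X ⇔ₛ X′ → S ⇔ᵣ S′ → R ⇔ᵣ R′ →
                     CatalanPair X S R → CatalanPair X′ S′ R′
  CatalanPair-resp (X⊆ , ⊆X) (S⊆ , ⊆S) (R⊆ , ⊆R) C = record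
    { S-on = λ u v s → RelOn-weaken X⊆ C.S-on u v (⊆S s)
    ; R-on = λ u v r → RelOn-weaken X⊆ C.R-on u v (⊆R r)
    ; S-strict = strict-resp (S⊆ , ⊆S) C.S-strict
    ; R-strict = strict-resp (R⊆ , ⊆R) C.R-strict
    ; cover = λ u v p q ne →
        Sum.map (sym-mono R⊆ u v) (sym-mono S⊆ u v) (C.cover u v (⊆X p) (⊆X q) ne)
    ; disjoint = λ u v r s → C.disjoint u v (sym-mono ⊆R u v r) (sym-mono ⊆S u v s)
    ; compat = λ u v w s r → R⊆ (C.compat u v w (⊆S s) (⊆R r))
    }
    where module C = CatalanPair C

  catalan-top : ¬ X x → CatalanPair X S R →
                CatalanPair (X ∪ₛ ｛ x ｝) (S ∪ᵣ (X ×ᵣ ｛ x ｝)) R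
  catalan-top {X = X} {x = x} {S = S} {R = R} x∉X C = record
    { S-on = RelOn-∪ (RelOn-weaken inj₁ C.S-on) (RelOn-× inj₁ inj₂)
    ; R-on = RelOn-weaken inj₁ C.R-on
    ; S-strict = strict-top x∉X C.S-on C.S-strict
    ; R-strict = C.R-strict
    ; cover = cover
    ; disjoint = apart-from-one-side apart
    ; compat = compat
    }
    where
    module C = CatalanPair C
    S⁺ : Rel₂ U
    S⁺ = S ∪ᵣ (X ×ᵣ ｛ x ｝)
    S⊆S⁺ : S ⊆ᵣ S⁺
    S⊆S⁺ = inj₁
    cover : ∀ u v → (X ∪ₛ ｛ x ｝) u → (X ∪ₛ ｛ x ｝) v → ¬ u ≡ v →
            sym-closure R u v ⊎ sym-closure S⁺ u v
    cover u v (inj₁ p) (inj₁ q) ne =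
      Sum.map₂ (sym-mono S⊆S⁺ u v) (C.cover u v p q ne)
    cover u v (inj₁ p) (inj₂ q) ne = inj₂ (inj₁ (inj₂ (p , q)))
    cover u v (inj₂ p) (inj₁ q) ne = inj₂ (inj₂ (inj₂ (q , p)))
    cover u v (inj₂ refl) (inj₂ refl) ne = ⊥-elim (ne refl)
    -- R never involves x, whereas every new S-pair does.
    apart : ∀ u v → R u v → sym-closure S⁺ u v → ⊥
    apart u v r (inj₁ (inj₁ s)) = C.disjoint u v (inj₁ r) (inj₁ s)
    apart u v r (inj₂ (inj₁ s)) = C.disjoint u v (inj₁ r) (inj₂ s)
    apart u v r (inj₁ (inj₂ (_ , refl))) = x∉X (tgt C.R-on r)
    apart u v r (inj₂ (inj₂ (_ , refl))) = x∉X (src C.R-on r)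
    compat : ∀ u v w → S⁺ u v → R v w → R u w
    compat u v w (inj₁ s) r = C.compat u v w s r
    compat u v w (inj₂ (_ , refl)) r = ⊥-elim (x∉X (src C.R-on r))

  catalan-sum : Disjoint X Y →
    CatalanPair X S₁ R₁ → CatalanPair Y S₂ R₂ →
    CatalanPair (X ∪ₛ Y) (S₁ ∪ᵣ S₂) ((R₁ ∪ᵣ R₂) ∪ᵣ (X ×ᵣ Y))
  catalan-sum {X = X} {Y = Y} {S₁ = S₁} {R₁ = R₁} {S₂ = S₂} {R₂ = R₂}
              X∩Y C₁ C₂ = record
    { S-on = RelOn-∪ (RelOn-weaken inj₁ C₁.S-on) (RelOn-weaken inj₂ C₂.S-on)
    ; R-on = RelOn-∪ (RelOn-∪ (RelOn-weaken inj₁ C₁.R-on)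
                              (RelOn-weaken inj₂ C₂.R-on))
                     (RelOn-× inj₁ inj₂)
    ; S-strict = strict-disjoint-union X∩Y C₁.S-on C₂.S-on C₁.S-strict C₂.S-strict
    ; R-strict = strict-ordinal-sum X∩Y C₁.R-on C₂.R-on C₁.R-strict C₂.R-strict
    ; cover = cover
    ; disjoint = apart-from-one-side apart
    ; compat = compat
    }
    where
    module C₁ = CatalanPair C₁
    module C₂ = CatalanPair C₂
    S⊕ R⊕ : Rel₂ U
    S⊕ = S₁ ∪ᵣ S₂
    R⊕ = (R₁ ∪ᵣ R₂) ∪ᵣ (X ×ᵣ Y)
    S₁⊆S⊕ : S₁ ⊆ᵣ S⊕
    S₁⊆S⊕ = inj₁
    S₂⊆S⊕ : S₂ ⊆ᵣ S⊕
    S₂⊆S⊕ = inj₂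
    R₁⊆R⊕ : R₁ ⊆ᵣ R⊕
    R₁⊆R⊕ r = inj₁ (inj₁ r)
    R₂⊆R⊕ : R₂ ⊆ᵣ R⊕
    R₂⊆R⊕ r = inj₁ (inj₂ r)
    cover : ∀ u v → (X ∪ₛ Y) u → (X ∪ₛ Y) v → ¬ u ≡ v →
            sym-closure R⊕ u v ⊎ sym-closure S⊕ u v
    cover u v (inj₁ p) (inj₁ q) ne =
      Sum.map (sym-mono R₁⊆R⊕ u v) (sym-mono S₁⊆S⊕ u v) (C₁.cover u v p q ne)
    cover u v (inj₂ p) (inj₂ q) ne =
      Sum.map (sym-mono R₂⊆R⊕ u v) (sym-mono S₂⊆S⊕ u v) (C₂.cover u v p q ne)
    cover u v (inj₁ p) (inj₂ q) ne = inj₁ (inj₁ (inj₂ (p , q)))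
    cover u v (inj₂ p) (inj₁ q) ne = inj₁ (inj₂ (inj₂ (q , p)))
    -- An S-pair never leaves X or Y, while R₁, R₂ stay inside and the
    -- cross pairs go from X to Y.
    apart : ∀ u v → R⊕ u v → sym-closure S⊕ u v → ⊥
    apart u v r s with sym-∪ {θ = S₁} {φ = S₂} s
    apart u v (inj₁ (inj₁ r)) s | inj₁ s̄ = C₁.disjoint u v (inj₁ r) s̄
    apart u v (inj₁ (inj₁ r)) s | inj₂ s̄ =
      X∩Y u (src C₁.R-on r) (proj₁ (sym-on C₂.S-on s̄))
    apart u v (inj₁ (inj₂ r)) s | inj₁ s̄ =
      X∩Y u (proj₁ (sym-on C₁.S-on s̄)) (src C₂.R-on r)
    apart u v (inj₁ (inj₂ r)) s | inj₂ s̄ = C₂.disjoint u v (inj₁ r) s̄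
    apart u v (inj₂ (p , q)) s | inj₁ s̄ = X∩Y v (proj₂ (sym-on C₁.S-on s̄)) q
    apart u v (inj₂ (p , q)) s | inj₂ s̄ = X∩Y u p (proj₁ (sym-on C₂.S-on s̄))
    compat : ∀ u v w → S⊕ u v → R⊕ v w → R⊕ u w
    compat u v w (inj₁ s) (inj₁ (inj₁ r)) = inj₁ (inj₁ (C₁.compat u v w s r))
    compat u v w (inj₁ s) (inj₁ (inj₂ r)) =
      ⊥-elim (X∩Y v (tgt C₁.S-on s) (src C₂.R-on r))
    compat u v w (inj₁ s) (inj₂ (_ , q)) = inj₂ (src C₁.S-on s , q)
    compat u v w (inj₂ s) (inj₁ (inj₁ r)) =
      ⊥-elim (X∩Y v (src C₁.R-on r) (tgt C₂.S-on s))
    compat u v w (inj₂ s) (inj₁ (inj₂ r)) = inj₁ (inj₂ (C₂.compat u v w s r))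
    compat u v w (inj₂ s) (inj₂ (p , _)) = ⊥-elim (X∩Y v p (tgt C₂.S-on s))

swap-middle : ∀ {a} {P Q W : Set a} → (P ⊎ Q) ⊎ W → (P ⊎ W) ⊎ Q
swap-middle (inj₁ (inj₁ p)) = inj₁ (inj₁ p)
swap-middle (inj₁ (inj₂ q)) = inj₂ q
swap-middle (inj₂ w) = inj₁ (inj₂ w)

distrib-cross : ∀ {a} {Θ P Q W : Set a} →
                Θ ⊎ ((P ⊎ Q) × W) → (Θ ⊎ (P × W)) ⊎ (Q × W)
distrib-cross (inj₁ t) = inj₁ (inj₁ t)
distrib-cross (inj₂ (inj₁ p , w)) = inj₁ (inj₂ (p , w))
distrib-cross (inj₂ (inj₂ q , w)) = inj₂ (q , w)

collect-cross : ∀ {a} {Θ P Q W : Set a} →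
                (Θ ⊎ (P × W)) ⊎ (Q × W) → Θ ⊎ ((P ⊎ Q) × W)
collect-cross (inj₁ (inj₁ t)) = inj₁ t
collect-cross (inj₁ (inj₂ (p , w))) = inj₂ (inj₁ p , w)
collect-cross (inj₂ (q , w)) = inj₂ (inj₂ q , w)

-- The theorem: add x on top of the pair on X_A, then sum with the pair
-- on X_B.
proposition1 : ∀ {a} {U : Set a} (XA XB : Subset U) (x : U)
    (SA RA SB RB : Rel₂ U) →
    Finite XA → Finite XB →
    (∀ u → XA u → XB u → ⊥) →
    ¬ XA x → ¬ XB x →
    CatalanPair XA SA RA → CatalanPair XB SB RB →
    CatalanPair ((XA ∪ₛ XB) ∪ₛ ｛ x ｝)
    ((SA ∪ᵣ SB) ∪ᵣ (XA ×ᵣ ｛ x ｝))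
    (((RA ∪ᵣ RB) ∪ᵣ (XA ×ᵣ XB)) ∪ᵣ (｛ x ｝ ×ᵣ XB))
proposition1 XA XB x SA RA SB RB _ _ XA∩XB x∉XA x∉XB CA CB =
  CatalanPair-resp (swap-middle , swap-middle) (swap-middle , swap-middle)
                   (distrib-cross , collect-cross)
    (catalan-sum XA+x∩XB (catalan-top x∉XA CA) CB)
  where
  XA+x∩XB : Disjoint (XA ∪ₛ ｛ x ｝) XB
  XA+x∩XB u (inj₁ p) q = XA∩XB u p q
  XA+x∩XB u (inj₂ refl) q = x∉XB q
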